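{- Let $m\ge 2$ and let $f\in P_m$ be a periodic sequence. If $h$ is the additive order of $\mathrm{tr} f$ in $\mathbb{Z}_m$, then $\tau(\Sigma f)=h\cdot\tau(f)$.
   Context: $\mathbb{Z}_m=\mathbb{Z}/m\mathbb{Z}$, $\mathbb{N}=\{0,1,2,\dots\}$, and $S_m=\mathbb{Z}_m^{\mathbb{N}}$ is the $\mathbb{Z}_m$-module of sequences. The shift is $\theta(f)(n)=f(n+1)$. A sequence $f$ is periodic if $\theta^j f=f$ for some $j\ge1$; its period $\tau(f)$ is the least such $j$, and $P_m$ is the submodule of periodic sequences. The trace of $f\in P_m$ is $\mathrm{tr} f=\sum_{i=0}^{\tau(f)-1}f(i)$. The sum operator is $\Sigma f(0)=0$ and $\Sigma f(n)=f(n-1)+\Sigma f(n-1)$ for $n\ge1$. -}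

module Defs where

open import Data.Nat using (ℕ; zero; suc; _*_; _≤_; _<_; NonZero)
import Data.Nat as ℕ
open import Data.Nat.DivMod using (_mod_)
open import Data.Fin using (Fin; toℕ)
open import Data.Product using (_×_; ∃)
open import Relation.Binary.PropositionalEquality using (_≡_)

ℤ_ : (m : ℕ) → Set
ℤ m = Fin m

module _ {m : ℕ} .{{_ : NonZero m}} where

  0ₘ : ℤ m
  0ₘ = 0 mod m

  infixl 6 _+ₘ_
  _+ₘ_ : ℤ m → ℤ m → ℤ m
  a +ₘ b = (toℕ a ℕ.+ toℕ b) mod m

  _·ₘ_ : ℕ → ℤ m → ℤ m
  zero  ·ₘ a = 0ₘ
  suc n ·ₘ a = a +ₘ (n ·ₘ a)

  Seq : Set
  Seq = ℕ → ℤ m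

  θ : Seq → Seq
  θ f n = f (suc n)

  θ^ : ℕ → Seq → Seq
  θ^ zero f = f
  θ^ (suc j) f = θ (θ^ j f)

  FixedBy : ℕ → Seq → Set
  FixedBy j f = ∀ n → θ^ j f n ≡ f n

  Periodic : Seq → Set
  Periodic f = ∃ λ j → 1 ≤ j × FixedBy j f

  IsPeriod : Seq → ℕ → Set
  IsPeriod f p = 1 ≤ p × FixedBy p f × (∀ j → 1 ≤ j → FixedBy j f → p ≤ j)

  sumTo : Seq → ℕ → ℤ m
  sumTo f zero = 0ₘ
  sumTo f (suc k) = sumTo f k +ₘ f k

  -- trace, given the period p = τ(f)
  tr : Seq → ℕ → ℤ m
  tr f p = sumTo f p

  Σ : Seq → Seq
  Σ f zero = 0ₘ
  Σ f (suc n) = f n +ₘ Σ f n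

  IsAddOrder : ℤ m → ℕ → Set
  IsAddOrder a h = 1 ≤ h × h ·ₘ a ≡ 0ₘ × (∀ k → 1 ≤ k → k ·ₘ a ≡ 0ₘ → h ≤ k)

-- Unfolding the recursion of Σ over one period gives Σ f (k τ + n) = k · tr f + Σ f n,
-- so Σ f is fixed by k τ exactly when k · tr f = 0. Conversely, a shift fixing Σ f also
-- fixes its differences f, hence is a multiple k τ of the minimal period of f; thus the
-- periods of Σ f are the k τ with k · tr f = 0, the least of which is h τ.
module Submission where

open import Defs
open import Data.Nat using (ℕ; NonZero; _≤_; _*_; zero; suc; _+_; _∸_; _%_; _/_; _<_; s≤s; z≤n; >-nonZero)
open import Data.Nat.Properties
  using (+-comm; +-assoc; +-suc; +-identityʳ; m+[n∸m]≡n; <⇒≤; <⇒≱; *-mono-≤; *-monoˡ-≤)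
open import Data.Nat.DivMod
  using (_mod_; %-distribˡ-+; [m+n]%n≡m%n; m<n⇒m%n≡m; m%n<n; m≡m%n+[m/n]*n)
open import Data.Nat.Divisibility using (_∣_; divides; m%n≡0⇒n∣m)
open import Data.Fin using (Fin; toℕ)
open import Data.Fin.Properties using (toℕ-injective; toℕ-fromℕ<; toℕ<n)
open import Data.Product using (_,_)
open import Relation.Nullary using (contradiction)
open import Relation.Binary.PropositionalEquality
  using (_≡_; refl; sym; trans; cong; cong₂; subst; module ≡-Reasoning)

module ModularArithmetic {m : ℕ} .{{_ : NonZero m}} where

  open ≡-Reasoning

  toℕ-mod : ∀ x → toℕ (x mod m) ≡ x % m
  toℕ-mod x = toℕ-fromℕ< _

  mod-cong : ∀ {x y} → x % m ≡ y % m → x mod m ≡ y mod m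
  mod-cong {x} {y} e = toℕ-injective (trans (toℕ-mod x) (trans e (sym (toℕ-mod y))))

  toℕ-mod-id : (a : Fin m) → toℕ a mod m ≡ a
  toℕ-mod-id a = toℕ-injective (trans (toℕ-mod (toℕ a)) (m<n⇒m%n≡m (toℕ<n a)))

  mod-+ₘ : ∀ x y → x mod m +ₘ y mod m ≡ (x + y) mod m
  mod-+ₘ x y = mod-cong (begin
    (toℕ (x mod m) + toℕ (y mod m)) % m ≡⟨ cong₂ (λ u v → (u + v) % m) (toℕ-mod x) (toℕ-mod y) ⟩
    (x % m + y % m) % m                 ≡⟨ sym (%-distribˡ-+ x y m) ⟩
    (x + y) % m                         ∎)

  mod-self : m mod m ≡ 0ₘ
  mod-self = mod-cong ([m+n]%n≡m%n 0 m)

  +ₘ-comm : (a b : Fin m) → a +ₘ b ≡ b +ₘ a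
  +ₘ-comm a b = cong (_mod m) (+-comm (toℕ a) (toℕ b))

  +ₘ-assoc : (a b c : Fin m) → (a +ₘ b) +ₘ c ≡ a +ₘ (b +ₘ c)
  +ₘ-assoc a b c = begin
    (a +ₘ b) +ₘ c                       ≡⟨ cong (_ +ₘ_) (sym (toℕ-mod-id c)) ⟩
    (x + y) mod m +ₘ z mod m            ≡⟨ mod-+ₘ (x + y) z ⟩
    (x + y + z) mod m                   ≡⟨ cong (_mod m) (+-assoc x y z) ⟩
    (x + (y + z)) mod m                 ≡⟨ sym (mod-+ₘ x (y + z)) ⟩
    x mod m +ₘ (y + z) mod m            ≡⟨ cong₂ _+ₘ_ (toℕ-mod-id a) (sym (mod-+ₘ y z)) ⟩
    a +ₘ (y mod m +ₘ z mod m)           ≡⟨ cong₂ (λ u v → a +ₘ (u +ₘ v)) (toℕ-mod-id b) (toℕ-mod-id c) ⟩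
    a +ₘ (b +ₘ c)                       ∎
    where
    x y z : ℕ
    x = toℕ a
    y = toℕ b
    z = toℕ c

  +ₘ-identityˡ : (a : Fin m) → 0ₘ +ₘ a ≡ a
  +ₘ-identityˡ a = begin
    0ₘ +ₘ a                 ≡⟨ cong (0ₘ +ₘ_) (sym (toℕ-mod-id a)) ⟩
    0 mod m +ₘ toℕ a mod m  ≡⟨ mod-+ₘ 0 (toℕ a) ⟩
    toℕ a mod m             ≡⟨ toℕ-mod-id a ⟩
    a                       ∎

  +ₘ-identityʳ : (a : Fin m) → a +ₘ 0ₘ ≡ a
  +ₘ-identityʳ a = trans (+ₘ-comm a 0ₘ) (+ₘ-identityˡ a)

  +ₘ-leftComm : (a b c : Fin m) → a +ₘ (b +ₘ c) ≡ b +ₘ (a +ₘ c)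
  +ₘ-leftComm a b c = begin
    a +ₘ (b +ₘ c)  ≡⟨ sym (+ₘ-assoc a b c) ⟩
    (a +ₘ b) +ₘ c  ≡⟨ cong (_+ₘ c) (+ₘ-comm a b) ⟩
    (b +ₘ a) +ₘ c  ≡⟨ +ₘ-assoc b a c ⟩
    b +ₘ (a +ₘ c)  ∎

  -ₘ_ : Fin m → Fin m
  -ₘ a = (m ∸ toℕ a) mod m

  +ₘ-inverseʳ : (a : Fin m) → a +ₘ -ₘ a ≡ 0ₘ
  +ₘ-inverseʳ a = begin
    a +ₘ -ₘ a                     ≡⟨ cong (_+ₘ -ₘ a) (sym (toℕ-mod-id a)) ⟩
    toℕ a mod m +ₘ -ₘ a           ≡⟨ mod-+ₘ (toℕ a) (m ∸ toℕ a) ⟩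
    (toℕ a + (m ∸ toℕ a)) mod m   ≡⟨ cong (_mod m) (m+[n∸m]≡n (<⇒≤ (toℕ<n a))) ⟩
    m mod m                       ≡⟨ mod-self ⟩
    0ₘ                            ∎

  +ₘ-cancelʳ : (a b c : Fin m) → a +ₘ c ≡ b +ₘ c → a ≡ b
  +ₘ-cancelʳ a b c e = begin
    a                        ≡⟨ undo a ⟩
    (a +ₘ c) +ₘ -ₘ c         ≡⟨ cong (_+ₘ -ₘ c) e ⟩
    (b +ₘ c) +ₘ -ₘ c         ≡⟨ sym (undo b) ⟩
    b                        ∎
    where
    undo : (x : Fin m) → x ≡ (x +ₘ c) +ₘ -ₘ c
    undo x = sym (trans (+ₘ-assoc x c (-ₘ c))
                        (trans (cong (x +ₘ_) (+ₘ-inverseʳ c)) (+ₘ-identityʳ x)))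

open ModularArithmetic

module Shifts {m : ℕ} .{{_ : NonZero m}} where

  open ≡-Reasoning

  θ^-apply : ∀ j (f : Seq {m}) n → θ^ j f n ≡ f (j + n)
  θ^-apply zero    f n = refl
  θ^-apply (suc j) f n = trans (θ^-apply j f (suc n)) (cong f (+-suc j n))

  FixedBy-apply : ∀ {f : Seq {m}} j → FixedBy j f → ∀ n → f (j + n) ≡ f n
  FixedBy-apply {f} j fix n = trans (sym (θ^-apply j f n)) (fix n)

  FixedBy-intro : ∀ {f : Seq {m}} j → (∀ n → f (j + n) ≡ f n) → FixedBy j f
  FixedBy-intro {f} j fix n = trans (θ^-apply j f n) (fix n)

  FixedBy-* : ∀ {f : Seq {m}} p → FixedBy p f → ∀ k → FixedBy (k * p) f
  FixedBy-* {f} p fix k = FixedBy-intro (k * p) (go k)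
    where
    go : ∀ k n → f (k * p + n) ≡ f n
    go zero    n = refl
    go (suc k) n = begin
      f (p + k * p + n)    ≡⟨ cong f (+-assoc p (k * p) n) ⟩
      f (p + (k * p + n))  ≡⟨ FixedBy-apply p fix (k * p + n) ⟩
      f (k * p + n)        ≡⟨ go k n ⟩
      f n                  ∎

  FixedBy-+⁻ʳ : ∀ {f : Seq {m}} a b → FixedBy a f → FixedBy (a + b) f → FixedBy b f
  FixedBy-+⁻ʳ {f} a b fixa fixab = FixedBy-intro b λ n → begin
    f (b + n)        ≡⟨ sym (FixedBy-apply a fixa (b + n)) ⟩
    f (a + (b + n))  ≡⟨ cong f (sym (+-assoc a b n)) ⟩
    f (a + b + n)    ≡⟨ FixedBy-apply (a + b) fixab n ⟩
    f n              ∎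

  FixedBy-% : ∀ {f : Seq {m}} p j .{{_ : NonZero p}} →
              FixedBy p f → FixedBy j f → FixedBy (j % p) f
  FixedBy-% {f} p j fixp fixj = FixedBy-+⁻ʳ (j / p * p) (j % p) (FixedBy-* p fixp (j / p)) fixj′
    where
    fixj′ : FixedBy (j / p * p + j % p) f
    fixj′ = subst (λ i → FixedBy i f)
                  (trans (m≡m%n+[m/n]*n j p) (+-comm (j % p) (j / p * p))) fixj

  period-∣ : ∀ {f : Seq {m}} {p} j → IsPeriod f p → FixedBy j f → p ∣ j
  period-∣ {f} {p} j (1≤p , fixp , minimal) fixj = divides-j
    where
    instance
      p≢0 : NonZero p
      p≢0 = >-nonZero 1≤p
    divides-j : p ∣ j
    divides-j with j % p in eq | FixedBy-% p j fixp fixj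
    ... | zero  | _    = m%n≡0⇒n∣m j p eq
    ... | suc r | fixr = contradiction (minimal (suc r) (s≤s z≤n) fixr)
                                       (<⇒≱ (subst (_< p) eq (m%n<n j p)))

open Shifts

module PartialSums {m : ℕ} .{{_ : NonZero m}} where

  open ≡-Reasoning

  Σ≡sumTo : ∀ (f : Seq {m}) n → Σ f n ≡ sumTo f n
  Σ≡sumTo f zero    = refl
  Σ≡sumTo f (suc n) = trans (cong (f n +ₘ_) (Σ≡sumTo f n)) (+ₘ-comm (f n) (sumTo f n))

  Σ-+-period : ∀ {f : Seq {m}} p → FixedBy p f → ∀ n → Σ f (p + n) ≡ tr f p +ₘ Σ f n
  Σ-+-period {f} p fix zero = begin
    Σ f (p + 0)     ≡⟨ cong (Σ f) (+-identityʳ p) ⟩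
    Σ f p           ≡⟨ Σ≡sumTo f p ⟩
    tr f p          ≡⟨ sym (+ₘ-identityʳ (tr f p)) ⟩
    tr f p +ₘ 0ₘ    ∎
  Σ-+-period {f} p fix (suc n) = begin
    Σ f (p + suc n)                ≡⟨ cong (Σ f) (+-suc p n) ⟩
    f (p + n) +ₘ Σ f (p + n)       ≡⟨ cong₂ _+ₘ_ (FixedBy-apply p fix n) (Σ-+-period p fix n) ⟩
    f n +ₘ (tr f p +ₘ Σ f n)       ≡⟨ +ₘ-leftComm (f n) (tr f p) (Σ f n) ⟩
    tr f p +ₘ Σ f (suc n)          ∎

  Σ-*-period : ∀ {f : Seq {m}} p → FixedBy p f →
               ∀ k n → Σ f (k * p + n) ≡ k ·ₘ tr f p +ₘ Σ f n
  Σ-*-period {f} p fix zero    n = sym (+ₘ-identityˡ (Σ f n))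
  Σ-*-period {f} p fix (suc k) n = begin
    Σ f (p + k * p + n)                 ≡⟨ cong (Σ f) (+-assoc p (k * p) n) ⟩
    Σ f (p + (k * p + n))               ≡⟨ Σ-+-period p fix (k * p + n) ⟩
    tr f p +ₘ Σ f (k * p + n)           ≡⟨ cong (tr f p +ₘ_) (Σ-*-period p fix k n) ⟩
    tr f p +ₘ (k ·ₘ tr f p +ₘ Σ f n)    ≡⟨ sym (+ₘ-assoc (tr f p) (k ·ₘ tr f p) (Σ f n)) ⟩
    suc k ·ₘ tr f p +ₘ Σ f n            ∎

  ·ₘtr≡0⇒FixedBy-Σ : ∀ {f : Seq {m}} p → FixedBy p f →
                     ∀ k → k ·ₘ tr f p ≡ 0ₘ → FixedBy (k * p) (Σ f)
  ·ₘtr≡0⇒FixedBy-Σ {f} p fix k k·t≡0 = FixedBy-intro (k * p) λ n → begin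
    Σ f (k * p + n)           ≡⟨ Σ-*-period p fix k n ⟩
    k ·ₘ tr f p +ₘ Σ f n      ≡⟨ cong (_+ₘ Σ f n) k·t≡0 ⟩
    0ₘ +ₘ Σ f n               ≡⟨ +ₘ-identityˡ (Σ f n) ⟩
    Σ f n                     ∎

  FixedBy-Σ⇒·ₘtr≡0 : ∀ {f : Seq {m}} p → FixedBy p f →
                     ∀ k → FixedBy (k * p) (Σ f) → k ·ₘ tr f p ≡ 0ₘ
  FixedBy-Σ⇒·ₘtr≡0 {f} p fix k fixΣ = begin
    k ·ₘ tr f p               ≡⟨ sym (+ₘ-identityʳ (k ·ₘ tr f p)) ⟩
    k ·ₘ tr f p +ₘ Σ f 0      ≡⟨ sym (Σ-*-period p fix k 0) ⟩
    Σ f (k * p + 0)           ≡⟨ FixedBy-apply (k * p) fixΣ 0 ⟩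
    0ₘ                        ∎

  FixedBy-Σ⇒FixedBy : ∀ {f : Seq {m}} j → FixedBy j (Σ f) → FixedBy j f
  FixedBy-Σ⇒FixedBy {f} j fixΣ = FixedBy-intro j λ n → +ₘ-cancelʳ _ _ (Σ f n) (begin
    f (j + n) +ₘ Σ f n          ≡⟨ cong (f (j + n) +ₘ_) (sym (FixedBy-apply j fixΣ n)) ⟩
    Σ f (suc (j + n))           ≡⟨ cong (Σ f) (sym (+-suc j n)) ⟩
    Σ f (j + suc n)             ≡⟨ FixedBy-apply j fixΣ (suc n) ⟩
    f n +ₘ Σ f n                ∎)

open PartialSums

lemma1p2 : (m : ℕ) .{{_ : NonZero m}} → 2 ≤ m →
    (f : Seq {m}) → Periodic f →
    (τf h : ℕ) → IsPeriod f τf → IsAddOrder (tr f τf) h →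
    IsPeriod (Σ f) (h * τf)
lemma1p2 m _ f _ τ h per@(1≤τ , fixτ , _) (1≤h , h·t≡0 , h-least) =
  *-mono-≤ 1≤h 1≤τ , ·ₘtr≡0⇒FixedBy-Σ τ fixτ h h·t≡0 , least
  where
  least : ∀ j → 1 ≤ j → FixedBy j (Σ f) → h * τ ≤ j
  least j 1≤j fixΣ with period-∣ j per (FixedBy-Σ⇒FixedBy j fixΣ)
  ... | divides zero    refl = contradiction 1≤j λ ()
  ... | divides (suc k) refl =
    *-monoˡ-≤ τ (h-least (suc k) (s≤s z≤n) (FixedBy-Σ⇒·ₘtr≡0 τ fixτ (suc k) fixΣ))
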